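{- Let $\lambda\neq0$ be a complex number, $u\in\mathbb{C}$ with $u\neq1$, and $r\in\mathbb{N}$. For every integer $m\ge0$, \[ H^{(r)}_m(x|u)=\sum_{n=0}^{m}h^{(r)}_{n,\lambda}(x|u)\,\lambda^{m-n}S_2(m,n). \]
   Context: For $\lambda\neq0$, $(x|\lambda)_0=1$ and $(x|\lambda)_n=x(x-\lambda)\cdots(x-(n-1)\lambda)$; $(1+\lambda t)^{x/\lambda}$ denotes the formal power series $\sum_{n\ge0}(x|\lambda)_n t^n/n!$. The degenerate Frobenius–Euler polynomials of order $r$ are defined by \[ \left(\frac{1-u}{(1+\lambda t)^{1/\lambda}-u}\right)^r(1+\lambda t)^{x/\lambda}=\sum_{n=0}^\infty h^{(r)}_{n,\lambda}(x|u)\frac{t^n}{n!}, \] and the higher-order Frobenius–Euler polynomials by \[ \left(\frac{1-u}{e^t-u}\right)^r e^{xt}=\sum_{n=0}^\infty H^{(r)}_n(x|u)\frac{t^n}{n!}. \] $S_2(m,n)$ are the Stirling numbers of the second kind, defined by $x^m=\sum_{n=0}^m S_2(m,n)(x)_n$, where $(x)_0=1$, $(x)_n=x(x-1)\cdots(x-n+1)$. -}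

module Defs where

open import Level using (Level; _⊔_)
open import Algebra.Bundles using (CommutativeRing)
open import Data.Nat as ℕ using (ℕ; zero; suc; _∸_; _≤?_)
open import Data.Nat.Combinatorics using (_C_)
open import Relation.Nullary using (¬_; yes; no)
import Algebra.Properties.Group as GroupProps

-- A field of characteristic zero (e.g. ℂ), given as a commutative cring
-- together with multiplicative inverses of nonzero elements, 0 ≠ 1,
-- and n·1 ≠ 0 for every positive integer n.
module _ {c ℓ : Level} (R : CommutativeRing c ℓ) where
  open CommutativeRing R

  ℕ→R : ℕ → Carrier
  ℕ→R zero    = 0#
  ℕ→R (suc n) = 1# + ℕ→R n

record CharZeroField (c ℓ : Level) : Set (Level.suc (c ⊔ ℓ)) where
  field
    cring : CommutativeRing c ℓ
  open CommutativeRing cring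
  field
    inv        : (x : Carrier) → ¬ (x ≈ 0#) → Carrier
    inv-right  : (x : Carrier) (p : ¬ (x ≈ 0#)) → x * inv x p ≈ 1#
    0≉1        : ¬ (0# ≈ 1#)
    charZero   : (n : ℕ) → ¬ (ℕ→R cring (suc n) ≈ 0#)

module Series {c ℓ : Level} (F : CharZeroField c ℓ) where
  open CharZeroField F
  open CommutativeRing cring

  sumTo : ℕ → (ℕ → Carrier) → Carrier
  sumTo zero    f = f 0
  sumTo (suc n) f = sumTo n f + f (suc n)

  -- Formal power series  Σ_n a n · t^n / n!  represented by the sequence a
  -- of coefficients of t^n/n! ("exponential generating functions").
  EGF : Set c
  EGF = ℕ → Carrier

  _⊛_ : EGF → EGF → EGF
  (a ⊛ b) n = sumTo n (λ k → ℕ→R cring (n C k) * (a k * b (n ∸ k)))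

  oneS : EGF
  oneS zero    = 1#
  oneS (suc n) = 0#

  constS : Carrier → EGF
  constS x zero    = x
  constS x (suc n) = 0#

  _⊖_ : EGF → EGF → EGF
  (a ⊖ b) n = a n - b n

  _^S_ : EGF → ℕ → EGF
  a ^S zero  = oneS
  a ^S suc r = a ⊛ (a ^S r)

  -- Multiplicative inverse of a series a, given an inverse c of its constant
  -- term: g 0 = c,  g n = - c · Σ_{j=1}^{n} C(n,j) a_j g_{n-j}.
  -- recipUpTo n k is correct for all k ≤ n.
  recipUpTo : EGF → Carrier → ℕ → EGF
  recipUpTo a c zero    k = c
  recipUpTo a c (suc n) k with k ≤? n
  ... | yes _ = recipUpTo a c n k
  ... | no  _ = - (c * sumTo n (λ j →
                   ℕ→R cring (suc n C suc j) * (a (suc j) * recipUpTo a c n (n ∸ j))))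

  recip : EGF → Carrier → EGF
  recip a c n = recipUpTo a c n n

  fallingλ : Carrier → Carrier → ℕ → Carrier
  fallingλ x l zero    = 1#
  fallingλ x l (suc n) = fallingλ x l n * (x - ℕ→R cring n * l)

  -- (1+λt)^{x/λ} = Σ (x|λ)_n t^n/n!
  degExp : Carrier → Carrier → EGF
  degExp l x = fallingλ x l

  -- e^{xt} = Σ x^n t^n/n!
  powR : Carrier → ℕ → Carrier
  powR x zero    = 1#
  powR x (suc n) = x * powR x n

  expS : Carrier → EGF
  expS x = powR x

  1-u≉0 : (u : Carrier) → ¬ (u ≈ 1#) → ¬ ((1# - u) ≈ 0#)
  1-u≉0 u u≉1 eq = u≉1 (sym (GroupProps.x∙y⁻¹≈ε⇒x≈y +-group 1# u eq))

  -- ((1-u)/(E - u))^r · G   where E has constant term 1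
  frobGF : (E G : EGF) (u : Carrier) → ¬ (u ≈ 1#) → ℕ → EGF
  frobGF E G u u≉1 r =
    ((constS (1# - u) ⊛ recip (E ⊖ constS u) (inv (1# - u) (1-u≉0 u u≉1))) ^S r) ⊛ G

  H : (r : ℕ) (u : Carrier) → ¬ (u ≈ 1#) → (n : ℕ) → Carrier → Carrier
  H r u u≉1 n x = frobGF (expS 1#) (expS x) u u≉1 r n

  h : (r : ℕ) (l u : Carrier) → ¬ (u ≈ 1#) → (n : ℕ) → Carrier → Carrier
  h r l u u≉1 n x = frobGF (degExp l 1#) (degExp l x) u u≉1 r n

-- Stirling numbers of the second kind (standard recurrence, equivalent to
-- x^m = Σ_n S₂(m,n) (x)_n)
S₂ : ℕ → ℕ → ℕ
S₂ zero    zero    = 1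
S₂ zero    (suc k) = 0
S₂ (suc m) zero    = 0
S₂ (suc m) (suc k) = suc k ℕ.* S₂ m (suc k) ℕ.+ S₂ m k

module Submission where

-- The identity  H^{(r)}_m(x|u) = Σ_{n≤m} h^{(r)}_{n,λ}(x|u) λ^{m-n} S₂(m,n)  is the
-- coefficient form of the substitution  t ↦ (e^{λt} - 1)/λ.  On exponential
-- generating functions (coefficient sequences a, a n the coefficient of t^n/n!)
-- this substitution is the linear map
--     (Φ a)_m = Σ_{n≤m} a_n λ^{m-n} S₂(m,n).

open import Defs
open import Algebra.Bundles using (CommutativeRing)
open import Data.Nat using (ℕ; _∸_)
open import Relation.Nullary using (¬_)
open import Level using (Level)
open import Data.Nat as ℕ using (zero; suc; _≤_; _<_; z≤n; s≤s)
import Data.Nat.Properties as ℕₚ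
open import Data.Nat.Combinatorics using (_C_; k>n⇒nCk≡0; nCk+nC[k+1]≡[n+1]C[k+1])
open import Data.Nat.Induction using (<-rec)
open import Data.Maybe using (nothing)
open import Data.Empty using (⊥-elim)
open import Relation.Nullary using (yes; no)
import Relation.Binary.PropositionalEquality as P
open P using (_≡_)
import Relation.Binary.Reasoning.Setoid as SetoidReasoning

S₂-vanish : ∀ {m k} → m < k → S₂ m k ≡ 0
S₂-vanish {zero}  {suc k} _          = P.refl
S₂-vanish {suc m} {suc k} (s≤s m<k) =
  P.cong₂ ℕ._+_
    (P.trans (P.cong (suc k ℕ.*_) (S₂-vanish (ℕₚ.m<n⇒m<1+n m<k))) (ℕₚ.*-zeroʳ (suc k)))
    (S₂-vanish m<k)

suc-∸ : ∀ {n k} → k ≤ n → suc n ∸ k ≡ suc (n ∸ k)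
suc-∸ = ℕₚ.+-∸-assoc 1

module Transfer {c′ ℓ : Level} (F : CharZeroField c′ ℓ) where
  open CharZeroField F
  open CommutativeRing cring
  open Series F
  open SetoidReasoning setoid
  open import Algebra.Properties.Ring ring using (-‿distribˡ-*; -‿distribʳ-*)
  open import Algebra.Properties.AbelianGroup +-abelianGroup using (⁻¹-∙-comm)
  open import Algebra.Properties.Group +-group using (inverseˡ-unique)
  open import Algebra.Properties.Semiring.Mult semiring using (_×_; ×-homo-+; ×1-homo-*)
  open import Algebra.Solver.Ring.NaturalCoefficients commutativeSemiring (λ _ _ → nothing)

  ℕR : ℕ → Carrier
  ℕR = ℕ→R cring

  ℕR≈× : ∀ n → ℕR n ≈ n × 1#
  ℕR≈× zero    = refl
  ℕR≈× (suc n) = +-congˡ (ℕR≈× n)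

  ℕR-+ : ∀ m n → ℕR (m ℕ.+ n) ≈ ℕR m + ℕR n
  ℕR-+ m n = trans (ℕR≈× (m ℕ.+ n))
    (trans (×-homo-+ 1# m n) (sym (+-cong (ℕR≈× m) (ℕR≈× n))))

  ℕR-* : ∀ m n → ℕR (m ℕ.* n) ≈ ℕR m * ℕR n
  ℕR-* m n = trans (ℕR≈× (m ℕ.* n))
    (trans (×1-homo-* m n) (sym (*-cong (ℕR≈× m) (ℕR≈× n))))

  ℕR-1 : ∀ y → ℕR 1 * y ≈ y
  ℕR-1 y = trans (*-congʳ (+-identityʳ 1#)) (*-identityˡ y)

  absorb-ℕR0 : ∀ x y {n} → n ≡ 0 → x * (y * ℕR n) ≈ 0#
  absorb-ℕR0 x y P.refl = trans (*-congˡ (zeroʳ y)) (zeroʳ x)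

  ℕR-S₂-suc : ∀ m k →
    ℕR (S₂ (suc m) (suc k)) ≈ ℕR (suc k) * ℕR (S₂ m (suc k)) + ℕR (S₂ m k)
  ℕR-S₂-suc m k =
    trans (ℕR-+ (suc k ℕ.* S₂ m (suc k)) (S₂ m k)) (+-congʳ (ℕR-* (suc k) (S₂ m (suc k))))

  ℕR-pascal : ∀ n k → ℕR (suc n C suc k) ≈ ℕR (n C k) + ℕR (n C suc k)
  ℕR-pascal n k = trans (reflexive (P.cong ℕR (P.sym (nCk+nC[k+1]≡[n+1]C[k+1] n k))))
                        (ℕR-+ (n C k) (n C suc k))

  sumTo-cong : ∀ n {f g : ℕ → Carrier} → (∀ k → k ≤ n → f k ≈ g k) → sumTo n f ≈ sumTo n g
  sumTo-cong zero    f≈g = f≈g 0 z≤n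
  sumTo-cong (suc n) f≈g =
    +-cong (sumTo-cong n (λ k k≤n → f≈g k (ℕₚ.m≤n⇒m≤1+n k≤n))) (f≈g (suc n) ℕₚ.≤-refl)

  sumTo-+ : ∀ n (f g : ℕ → Carrier) → sumTo n (λ k → f k + g k) ≈ sumTo n f + sumTo n g
  sumTo-+ zero    f g = refl
  sumTo-+ (suc n) f g = trans (+-congʳ (sumTo-+ n f g))
    (solve 4 (λ a b x y → (a :+ b) :+ (x :+ y) := (a :+ x) :+ (b :+ y)) refl
      (sumTo n f) (sumTo n g) (f (suc n)) (g (suc n)))

  sumTo-* : ∀ n t (f : ℕ → Carrier) → sumTo n (λ k → t * f k) ≈ t * sumTo n f
  sumTo-* zero    t f = refl
  sumTo-* (suc n) t f = trans (+-congʳ (sumTo-* n t f)) (sym (distribˡ t _ _))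

  sumTo-neg : ∀ n (f : ℕ → Carrier) → sumTo n (λ k → - f k) ≈ - sumTo n f
  sumTo-neg zero    f = refl
  sumTo-neg (suc n) f = trans (+-congʳ (sumTo-neg n f)) (⁻¹-∙-comm _ _)

  sumTo-0 : ∀ n (f : ℕ → Carrier) → (∀ k → k ≤ n → f k ≈ 0#) → sumTo n f ≈ 0#
  sumTo-0 n f f≈0 = trans (sumTo-cong n f≈0) (sumTo-zeros n)
    where
    sumTo-zeros : ∀ n → sumTo n (λ _ → 0#) ≈ 0#
    sumTo-zeros zero    = refl
    sumTo-zeros (suc n) = trans (+-identityʳ _) (sumTo-zeros n)

  sumTo-peel : ∀ n (f : ℕ → Carrier) → sumTo (suc n) f ≈ f 0 + sumTo n (λ k → f (suc k))
  sumTo-peel zero    f = refl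
  sumTo-peel (suc n) f = trans (+-congʳ (sumTo-peel n f)) (+-assoc _ _ _)

  sumTo-reindex : ∀ n (f : ℕ → Carrier) → f (suc n) ≈ 0# →
                  sumTo n f ≈ f 0 + sumTo n (λ k → f (suc k))
  sumTo-reindex n f top≈0 = trans (sym (trans (+-congˡ top≈0) (+-identityʳ _))) (sumTo-peel n f)

  record _≋_ (a b : EGF) : Set ℓ where
    constructor coeffwise
    field coeff : ∀ n → a n ≈ b n
  open _≋_ public

  ≋-refl : ∀ {a} → a ≋ a
  ≋-refl = coeffwise λ _ → refl

  ≋-sym : ∀ {a b} → a ≋ b → b ≋ a
  ≋-sym a≋b = coeffwise λ n → sym (coeff a≋b n)

  ≋-trans : ∀ {a b e} → a ≋ b → b ≋ e → a ≋ e
  ≋-trans a≋b b≋e = coeffwise λ n → trans (coeff a≋b n) (coeff b≋e n)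

  _⊕_ : EGF → EGF → EGF
  (a ⊕ b) n = a n + b n

  _⋅_ : Carrier → EGF → EGF
  (t ⋅ a) n = t * a n

  -- derivative d/dt
  ∂ : EGF → EGF
  ∂ a n = a (suc n)

  -- Euler operator t·d/dt
  θ : EGF → EGF
  θ a n = ℕR n * a n

  ⊛-at-0 : ∀ a b → (a ⊛ b) 0 ≈ a 0 * b 0
  ⊛-at-0 a b = ℕR-1 (a 0 * b 0)

  ⊛-cong : ∀ {a a' b b'} → a ≋ a' → b ≋ b' → (a ⊛ b) ≋ (a' ⊛ b')
  ⊛-cong a≋a' b≋b' = coeffwise λ n →
    sumTo-cong n (λ k _ → *-congˡ (*-cong (coeff a≋a' k) (coeff b≋b' (n ∸ k))))

  ⊛-linearˡ : ∀ t p q b n → (((t ⋅ p) ⊕ q) ⊛ b) n ≈ t * (p ⊛ b) n + (q ⊛ b) n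
  ⊛-linearˡ t p q b n = trans
    (sumTo-cong n (λ k _ → solve 5
      (λ C t x y z → C :* ((t :* x :+ y) :* z) := t :* (C :* (x :* z)) :+ C :* (y :* z)) refl
      (ℕR (n C k)) t (p k) (q k) (b (n ∸ k))))
    (trans (sumTo-+ n _ _) (+-congʳ (sumTo-* n t _)))

  ⊛-linearʳ : ∀ t p q a n → (a ⊛ ((t ⋅ p) ⊕ q)) n ≈ t * (a ⊛ p) n + (a ⊛ q) n
  ⊛-linearʳ t p q a n = trans
    (sumTo-cong n (λ k _ → solve 5
      (λ C t x y z → C :* (z :* (t :* x :+ y)) := t :* (C :* (z :* x)) :+ C :* (z :* y)) refl
      (ℕR (n C k)) t (p (n ∸ k)) (q (n ∸ k)) (a k)))
    (trans (sumTo-+ n _ _) (+-congʳ (sumTo-* n t _)))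

  -- Leibniz rule for the derivative, from Pascal's rule.
  ∂-⊛ : ∀ a b n → (a ⊛ b) (suc n) ≈ (∂ a ⊛ b) n + (a ⊛ ∂ b) n
  ∂-⊛ a b n = begin
      (a ⊛ b) (suc n)
    ≈⟨ sumTo-peel n _ ⟩
      T 0 + sumTo n (λ k → ℕR (suc n C suc k) * (a (suc k) * b (n ∸ k)))
    ≈⟨ +-congˡ (sumTo-cong n (λ k _ → trans (*-congʳ (ℕR-pascal n k)) (distribʳ _ _ _))) ⟩
      T 0 + sumTo n (λ k → ℕR (n C k) * (a (suc k) * b (n ∸ k)) + T (suc k))
    ≈⟨ +-congˡ (sumTo-+ n _ _) ⟩
      T 0 + ((∂ a ⊛ b) n + sumTo n (λ k → T (suc k)))
    ≈⟨ solve 3 (λ x y z → x :+ (y :+ z) := y :+ (x :+ z)) refl (T 0) ((∂ a ⊛ b) n) _ ⟩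
      (∂ a ⊛ b) n + (T 0 + sumTo n (λ k → T (suc k)))
    ≈⟨ +-congˡ (sym (sumTo-reindex n T (absorb-C (k>n⇒nCk≡0 {n} ℕₚ.≤-refl)))) ⟩
      (∂ a ⊛ b) n + sumTo n T
    ≈⟨ +-congˡ (sumTo-cong n (λ k k≤n → reflexive
          (P.cong (λ i → ℕR (n C k) * (a k * b i)) (suc-∸ k≤n)))) ⟩
      (∂ a ⊛ b) n + (a ⊛ ∂ b) n
    ∎
    where
    -- the terms of (a ⊛ ∂ b) n, indexed so that they also occur in (a ⊛ b) (n+1)
    T : ℕ → Carrier
    T k = ℕR (n C k) * (a k * b (suc n ∸ k))
    absorb-C : ∀ {k} → n C k ≡ 0 → T k ≈ 0#
    absorb-C eq = trans (*-congʳ (reflexive (P.cong ℕR eq))) (zeroˡ _)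

  -- Leibniz rule for the Euler operator, from n = k + (n - k).
  θ-⊛ : ∀ a b n → ℕR n * (a ⊛ b) n ≈ (θ a ⊛ b) n + (a ⊛ θ b) n
  θ-⊛ a b n = trans (sym (sumTo-* n (ℕR n) _)) (trans (sumTo-cong n split) (sumTo-+ n _ _))
    where
    split : ∀ k → k ≤ n → ℕR n * (ℕR (n C k) * (a k * b (n ∸ k))) ≈
              ℕR (n C k) * ((ℕR k * a k) * b (n ∸ k))
                + ℕR (n C k) * (a k * (ℕR (n ∸ k) * b (n ∸ k)))
    split k k≤n = trans
      (*-congʳ (trans (reflexive (P.cong ℕR (P.sym (ℕₚ.m+[n∸m]≡n k≤n)))) (ℕR-+ k (n ∸ k))))
      (solve 5 (λ p q C x y →
          (p :+ q) :* (C :* (x :* y)) := C :* ((p :* x) :* y) :+ C :* (x :* (q :* y))) refl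
         (ℕR k) (ℕR (n ∸ k)) (ℕR (n C k)) (a k) (b (n ∸ k)))

  module Reciprocal (a : EGF) (c : Carrier) (a₀c≈1 : a 0 * c ≈ 1#) where
    R : EGF
    R = recip a c

    recipUpTo-stable : ∀ {k n} → k ≤ n → recipUpTo a c n k ≡ R k
    recipUpTo-stable {k} {n} k≤n =
      P.subst (λ i → recipUpTo a c i k ≡ R k) (ℕₚ.m∸n+n≡m k≤n) (stable (n ∸ k))
      where
      stable : ∀ d → recipUpTo a c (d ℕ.+ k) k ≡ R k
      stable zero = P.refl
      stable (suc d) with k ℕ.≤? d ℕ.+ k
      ... | yes _  = stable d
      ... | no k≰ = ⊥-elim (k≰ (ℕₚ.m≤n+m k d))

    -- Σ_{j≤n} C(n+1,j+1) a_{j+1} s_{n-j}: the part of (a ⊛ s)(n+1) beyond a₀ s_{n+1}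
    tail : EGF → ℕ → Carrier
    tail s n = sumTo n (λ j → ℕR (suc n C suc j) * (a (suc j) * s (n ∸ j)))

    recip-suc : ∀ n → R (suc n) ≈ - (c * tail R n)
    recip-suc n with suc n ℕ.≤? n
    ... | yes n<n = ⊥-elim (ℕₚ.<-irrefl P.refl n<n)
    ... | no _    = -‿cong (*-congˡ (sumTo-cong n (λ j _ → reflexive
          (P.cong (λ v → ℕR (suc n C suc j) * (a (suc j) * v)) (recipUpTo-stable (ℕₚ.m∸n≤m n j))))))

    ⊛-suc : ∀ s n → (a ⊛ s) (suc n) ≈ a 0 * s (suc n) + tail s n
    ⊛-suc s n = trans (sumTo-peel n _) (+-congʳ (ℕR-1 _))

    cancel-a₀ : ∀ w → a 0 * (c * w) ≈ w
    cancel-a₀ w = trans (sym (*-assoc _ _ _)) (trans (*-congʳ a₀c≈1) (*-identityˡ w))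

    solve-a₀ : ∀ y w → a 0 * y ≈ w → y ≈ c * w
    solve-a₀ y w a₀y≈w = begin
        y              ≈⟨ sym (*-identityˡ y) ⟩
        1# * y         ≈⟨ *-congʳ (sym a₀c≈1) ⟩
        (a 0 * c) * y  ≈⟨ solve 3 (λ x c y → (x :* c) :* y := c :* (x :* y)) refl (a 0) c y ⟩
        c * (a 0 * y)  ≈⟨ *-congˡ a₀y≈w ⟩
        c * w          ∎

    recip-inverse : (a ⊛ R) ≋ oneS
    recip-inverse = coeffwise inverse
      where
      a₀R≈-tail : ∀ n → a 0 * R (suc n) ≈ - tail R n
      a₀R≈-tail n = trans (*-congˡ (recip-suc n))
                      (trans (sym (-‿distribʳ-* _ _)) (-‿cong (cancel-a₀ (tail R n))))
      inverse : ∀ n → (a ⊛ R) n ≈ oneS n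
      inverse zero    = trans (⊛-at-0 a R) a₀c≈1
      inverse (suc n) = begin
          (a ⊛ R) (suc n)              ≈⟨ ⊛-suc R n ⟩
          a 0 * R (suc n) + tail R n   ≈⟨ +-congʳ (a₀R≈-tail n) ⟩
          - tail R n + tail R n        ≈⟨ -‿inverseˡ _ ⟩
          0#                           ∎

    recip-unique : ∀ s → (a ⊛ s) ≋ oneS → s ≋ R
    recip-unique s a⊛s≈1 = coeffwise (<-rec (λ n → s n ≈ R n) agree)
      where
      agree : ∀ n → (∀ {k} → k < n → s k ≈ R k) → s n ≈ R n
      agree zero _ =
        trans (solve-a₀ (s 0) 1# (trans (sym (⊛-at-0 a s)) (coeff a⊛s≈1 0))) (*-identityʳ c)
      agree (suc n) below = begin
          s (suc n)          ≈⟨ solve-a₀ (s (suc n)) (- tail s n) a₀s≈-tail ⟩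
          c * - tail s n     ≈⟨ sym (-‿distribʳ-* _ _) ⟩
          - (c * tail s n)   ≈⟨ -‿cong (*-congˡ (sumTo-cong n (λ j _ →
                                 *-congˡ (*-congˡ (below (s≤s (ℕₚ.m∸n≤m n j))))))) ⟩
          - (c * tail R n)   ≈⟨ sym (recip-suc n) ⟩
          R (suc n)          ∎
        where
        a₀s≈-tail : a 0 * s (suc n) ≈ - tail s n
        a₀s≈-tail = inverseˡ-unique _ _ (trans (sym (⊛-suc s n)) (coeff a⊛s≈1 (suc n)))

  module _ (l : Carrier) where
    weight : ℕ → ℕ → Carrier
    weight m n = powR l (m ∸ n) * ℕR (S₂ m n)

    Φ : EGF → EGF
    Φ a m = sumTo m (λ n → a n * weight m n)

    Φ-cong : ∀ {a b} → a ≋ b → Φ a ≋ Φ b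
    Φ-cong a≋b = coeffwise λ m → sumTo-cong m (λ k _ → *-congʳ (coeff a≋b k))

    Φ-at-0 : ∀ a → Φ a 0 ≈ a 0
    Φ-at-0 a = trans (*-congˡ (trans (*-identityˡ _) (+-identityʳ 1#))) (*-identityʳ _)

    Φ-⊕ : ∀ a b m → Φ (a ⊕ b) m ≈ Φ a m + Φ b m
    Φ-⊕ a b m = trans (sumTo-cong m (λ k _ → distribʳ _ _ _)) (sumTo-+ m _ _)

    Φ-⋅ : ∀ t a m → Φ (t ⋅ a) m ≈ t * Φ a m
    Φ-⋅ t a m = trans (sumTo-cong m (λ k _ → *-assoc _ _ _)) (sumTo-* m t _)

    Φ-⊖ : ∀ a b → Φ (a ⊖ b) ≋ (Φ a ⊖ Φ b)
    Φ-⊖ a b = coeffwise λ m → trans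
      (sumTo-cong m (λ k _ → trans (distribʳ _ _ _) (+-congˡ (sym (-‿distribˡ-* _ _)))))
      (trans (sumTo-+ m _ _) (+-congˡ (sumTo-neg m _)))

    -- The Stirling recurrence as a differential equation:  ∂(Φ a) = λ·Φ(θ a) + Φ(∂ a).
    Φ-step : ∀ a m → Φ a (suc m) ≈ l * Φ (θ a) m + Φ (∂ a) m
    Φ-step a m = begin
        Φ a (suc m)
      ≈⟨ sumTo-peel m _ ⟩
        a 0 * weight (suc m) 0 + sumTo m (λ k → a (suc k) * weight (suc m) (suc k))
      ≈⟨ +-cong (absorb-ℕR0 (a 0) _ P.refl) (sumTo-cong m (λ k _ → split k)) ⟩
        0# + sumTo m (λ k → W (suc k) + ∂ a k * weight m k)
      ≈⟨ +-identityˡ _ ⟩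
        sumTo m (λ k → W (suc k) + ∂ a k * weight m k)
      ≈⟨ sumTo-+ m _ _ ⟩
        sumTo m (λ k → W (suc k)) + Φ (∂ a) m
      ≈⟨ +-congʳ (sym shifted) ⟩
        l * Φ (θ a) m + Φ (∂ a) m
      ∎
      where
      -- the terms of λ·Φ(θ a) m, written with exponent (m+1) - k
      W : ℕ → Carrier
      W k = θ a k * (powR l (suc m ∸ k) * ℕR (S₂ m k))
      split : ∀ k → a (suc k) * weight (suc m) (suc k) ≈ W (suc k) + ∂ a k * weight m k
      split k = trans (*-congˡ (*-congˡ (ℕR-S₂-suc m k)))
        (solve 5 (λ x p N S T →
            x :* (p :* (N :* S :+ T)) := (N :* x) :* (p :* S) :+ x :* (p :* T)) refl
          (a (suc k)) (powR l (m ∸ k)) (ℕR (suc k)) (ℕR (S₂ m (suc k))) (ℕR (S₂ m k)))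
      shifted : l * Φ (θ a) m ≈ sumTo m (λ k → W (suc k))
      shifted = begin
          l * Φ (θ a) m
        ≈⟨ sym (sumTo-* m l _) ⟩
          sumTo m (λ k → l * (θ a k * weight m k))
        ≈⟨ sumTo-cong m (λ k k≤m → trans
             (solve 4 (λ l x p S → l :* (x :* (p :* S)) := x :* ((l :* p) :* S)) refl
               l (θ a k) (powR l (m ∸ k)) (ℕR (S₂ m k)))
             (reflexive (P.cong (λ e → θ a k * (powR l e * ℕR (S₂ m k))) (P.sym (suc-∸ k≤m))))) ⟩
          sumTo m W
        ≈⟨ sumTo-reindex m W (absorb-ℕR0 _ _ (S₂-vanish {m} ℕₚ.≤-refl)) ⟩
          W 0 + sumTo m (λ k → W (suc k))
        ≈⟨ +-congʳ (trans (*-congʳ (zeroˡ (a 0))) (zeroˡ _)) ⟩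
          0# + sumTo m (λ k → W (suc k))
        ≈⟨ +-identityˡ _ ⟩
          sumTo m (λ k → W (suc k))
        ∎

    Φ-∂ : ∀ a → ∂ (Φ a) ≋ ((l ⋅ Φ (θ a)) ⊕ Φ (∂ a))
    Φ-∂ a = coeffwise (Φ-step a)

    -- Φ is multiplicative: both sides satisfy the same derivative recursion
    -- by the Leibniz rules for ∂ and θ.
    Φ-mult : ∀ m a b → Φ (a ⊛ b) m ≈ (Φ a ⊛ Φ b) m
    Φ-mult zero a b =
      trans (Φ-at-0 (a ⊛ b)) (trans (⊛-at-0 a b)
        (sym (trans (⊛-at-0 (Φ a) (Φ b)) (*-cong (Φ-at-0 a) (Φ-at-0 b)))))
    Φ-mult (suc m) a b = begin
        Φ (a ⊛ b) (suc m)
      ≈⟨ Φ-step (a ⊛ b) m ⟩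
        l * Φ (θ (a ⊛ b)) m + Φ (∂ (a ⊛ b)) m
      ≈⟨ +-cong (*-congˡ (coeff (Φ-cong (coeffwise (θ-⊛ a b))) m))
                (coeff (Φ-cong (coeffwise (∂-⊛ a b))) m) ⟩
        l * Φ ((θ a ⊛ b) ⊕ (a ⊛ θ b)) m + Φ ((∂ a ⊛ b) ⊕ (a ⊛ ∂ b)) m
      ≈⟨ +-cong (*-congˡ (Φ-⊕ _ _ m)) (Φ-⊕ _ _ m) ⟩
        l * (Φ (θ a ⊛ b) m + Φ (a ⊛ θ b) m) + (Φ (∂ a ⊛ b) m + Φ (a ⊛ ∂ b) m)
      ≈⟨ +-cong (*-congˡ (+-cong (Φ-mult m _ _) (Φ-mult m _ _)))
                (+-cong (Φ-mult m _ _) (Φ-mult m _ _)) ⟩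
        l * (p₁ + p₂) + (p₃ + p₄)
      ≈⟨ solve 5 (λ l p₁ p₂ p₃ p₄ →
             l :* (p₁ :+ p₂) :+ (p₃ :+ p₄) := (l :* p₁ :+ p₃) :+ (l :* p₂ :+ p₄)) refl
            l p₁ p₂ p₃ p₄ ⟩
        (l * p₁ + p₃) + (l * p₂ + p₄)
      ≈⟨ sym (+-cong (⊛-linearˡ l (Φ (θ a)) (Φ (∂ a)) (Φ b) m)
                     (⊛-linearʳ l (Φ (θ b)) (Φ (∂ b)) (Φ a) m)) ⟩
        (((l ⋅ Φ (θ a)) ⊕ Φ (∂ a)) ⊛ Φ b) m + (Φ a ⊛ ((l ⋅ Φ (θ b)) ⊕ Φ (∂ b))) m
      ≈⟨ sym (+-cong (coeff (⊛-cong (Φ-∂ a) (≋-refl {Φ b})) m)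
                     (coeff (⊛-cong (≋-refl {Φ a}) (Φ-∂ b)) m)) ⟩
        (∂ (Φ a) ⊛ Φ b) m + (Φ a ⊛ ∂ (Φ b)) m
      ≈⟨ sym (∂-⊛ (Φ a) (Φ b) m) ⟩
        (Φ a ⊛ Φ b) (suc m)
      ∎
      where
      p₁ = (Φ (θ a) ⊛ Φ b) m
      p₂ = (Φ a ⊛ Φ (θ b)) m
      p₃ = (Φ (∂ a) ⊛ Φ b) m
      p₄ = (Φ a ⊛ Φ (∂ b)) m

    Φ-⊛ : ∀ a b → Φ (a ⊛ b) ≋ (Φ a ⊛ Φ b)
    Φ-⊛ a b = coeffwise λ m → Φ-mult m a b

    Φ-fixes-constants : ∀ a → (∀ n → a (suc n) ≈ 0#) → Φ a ≋ a
    Φ-fixes-constants a a₊≈0 = coeffwise fixed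
      where
      vanish : ∀ {m} k → k ≤ suc m → a k * weight (suc m) k ≈ 0#
      vanish zero    _ = absorb-ℕR0 (a 0) _ P.refl
      vanish (suc k) _ = trans (*-congʳ (a₊≈0 k)) (zeroˡ _)
      fixed : ∀ m → Φ a m ≈ a m
      fixed zero    = Φ-at-0 a
      fixed (suc m) = trans (sumTo-0 (suc m) _ vanish) (sym (a₊≈0 m))

    Φ-const : ∀ t → Φ (constS t) ≋ constS t
    Φ-const t = Φ-fixes-constants (constS t) (λ _ → refl)

    Φ-one : Φ oneS ≋ oneS
    Φ-one = Φ-fixes-constants oneS (λ _ → refl)

    -- Φ maps (1+λt)^{x/λ} to e^{xt}, since (x|λ)_{n+1} = (x|λ)_n (x - nλ)
    -- says that F = (x|λ)_• satisfies  λ·θ F + ∂ F = x·F, like e^{xt} under ∂.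
    Φ-falling : ∀ x → Φ (fallingλ x l) ≋ powR x
    Φ-falling x = coeffwise go
      where
      Fx : EGF
      Fx = fallingλ x l
      recursion : ∀ k → l * (ℕR k * Fx k) + Fx k * (x - ℕR k * l) ≈ x * Fx k
      recursion k = trans
        (solve 5 (λ l n f x z →
            l :* (n :* f) :+ f :* (x :+ z) := x :* f :+ f :* (n :* l :+ z)) refl
          l (ℕR k) (Fx k) x (- (ℕR k * l)))
        (trans (+-congˡ (trans (*-congˡ (-‿inverseʳ _)) (zeroʳ _))) (+-identityʳ _))
      go : ∀ m → Φ Fx m ≈ powR x m
      go zero    = Φ-at-0 Fx
      go (suc m) = begin
          Φ Fx (suc m)                  ≈⟨ Φ-step Fx m ⟩
          l * Φ (θ Fx) m + Φ (∂ Fx) m   ≈⟨ +-congʳ (sym (Φ-⋅ l (θ Fx) m)) ⟩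
          Φ (l ⋅ θ Fx) m + Φ (∂ Fx) m   ≈⟨ sym (Φ-⊕ (l ⋅ θ Fx) (∂ Fx) m) ⟩
          Φ ((l ⋅ θ Fx) ⊕ ∂ Fx) m       ≈⟨ coeff (Φ-cong (coeffwise recursion)) m ⟩
          Φ (x ⋅ Fx) m                  ≈⟨ Φ-⋅ x Fx m ⟩
          x * Φ Fx m                    ≈⟨ *-congˡ (go m) ⟩
          x * powR x m                  ∎

    -- A ring homomorphism preserves reciprocals, by uniqueness of inverses.
    Φ-recip : ∀ {a a'} c → a 0 * c ≈ 1# → Φ a ≋ a' → Φ (recip a c) ≋ recip a' c
    Φ-recip {a} {a'} c a₀c≈1 Φa≋a' = Reciprocal.recip-unique a' c a'₀c≈1 (Φ R) a'⊛ΦR≋1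
      where
      R : EGF
      R = recip a c
      a'₀c≈1 : a' 0 * c ≈ 1#
      a'₀c≈1 = trans (*-congʳ (trans (sym (coeff Φa≋a' 0)) (Φ-at-0 a))) a₀c≈1
      a'⊛ΦR≋1 : (a' ⊛ Φ R) ≋ oneS
      a'⊛ΦR≋1 =
        ≋-trans (⊛-cong (≋-sym Φa≋a') (≋-refl {Φ R}))
          (≋-trans (≋-sym (Φ-⊛ a R))
            (≋-trans (Φ-cong (Reciprocal.recip-inverse a c a₀c≈1)) Φ-one))

    Φ-pow : ∀ {a a'} → Φ a ≋ a' → ∀ k → Φ (a ^S k) ≋ (a' ^S k)
    Φ-pow Φa≋a' zero    = Φ-one
    Φ-pow {a} Φa≋a' (suc k) = ≋-trans (Φ-⊛ a (a ^S k)) (⊛-cong Φa≋a' (Φ-pow Φa≋a' k))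

    Φ-frobGF : ∀ {E G E' G'} (u : Carrier) (u≉1 : ¬ (u ≈ 1#)) (r : ℕ) → E 0 ≈ 1# →
               Φ E ≋ E' → Φ G ≋ G' → Φ (frobGF E G u u≉1 r) ≋ frobGF E' G' u u≉1 r
    Φ-frobGF {E} {G} {E'} u u≉1 r E₀≈1 ΦE≋E' ΦG≋G' =
      ≋-trans (Φ-⊛ (Y ^S r) G) (⊛-cong (Φ-pow ΦY≋Y' r) ΦG≋G')
      where
      c : Carrier
      c = inv (1# - u) (1-u≉0 u u≉1)
      denominator₀ : (E ⊖ constS u) 0 * c ≈ 1#
      denominator₀ = trans (*-congʳ (+-congʳ E₀≈1)) (inv-right (1# - u) (1-u≉0 u u≉1))
      Y : EGF
      Y = constS (1# - u) ⊛ recip (E ⊖ constS u) c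
      ΦY≋Y' : Φ Y ≋ (constS (1# - u) ⊛ recip (E' ⊖ constS u) c)
      ΦY≋Y' = ≋-trans (Φ-⊛ _ _) (⊛-cong (Φ-const (1# - u)) (Φ-recip c denominator₀ Φdenominator))
        where
        Φdenominator : Φ (E ⊖ constS u) ≋ (E' ⊖ constS u)
        Φdenominator = ≋-trans (Φ-⊖ E (constS u))
          (coeffwise λ n → +-cong (coeff ΦE≋E' n) (-‿cong (coeff (Φ-const u) n)))

-- Specialise to E = (1+λt)^{1/λ}, G = (1+λt)^{x/λ}: their images are e^t and e^{xt}.
theorem5 : ∀ {c ℓ} (F : CharZeroField c ℓ) →
    let open CharZeroField F in
    let open CommutativeRing cring in
    let open Series F in
    (l u : Carrier) (l≉0 : ¬ (l ≈ 0#)) (u≉1 : ¬ (u ≈ 1#)) (r m : ℕ) (x : Carrier) →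
      H r u u≉1 m x ≈
        sumTo m (λ n → h r l u u≉1 n x * (powR l (m ∸ n) * ℕ→R cring (S₂ m n)))
theorem5 F l u _ u≉1 r m x =
  sym (coeff (Φ-frobGF l u u≉1 r refl (Φ-falling l 1#) (Φ-falling l x)) m)
  where
  open Transfer F
  open CommutativeRing (CharZeroField.cring F) using (1#; refl; sym)
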